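{- Let $A \in \mathbb{Z}^{n\times n}$ with $|\det(A)| = \Delta \neq 0$ and $b \in \mathbb{Z}^n$, let $C := \{x\in\mathbb{R}^n : Ax \leq b\}$, let $a'_1, \ldots, a'_n$ be the columns of $A^{ -1}$, let $u := A^{ -1}b$, and let $X$ be the convex hull of $C \cap \mathbb{Z}^n$. If $v = u - \sum_{i=1}^n \mu_i a'_i$ with $\mu_i \geq 0$ for $1\le i\le n$ is a vertex of $X$, then $\prod_{i=1}^n (\mu_i + 1) \leq \Delta$.
   Formalization: The vertex v and the coefficients μ_i are rational, and X is taken as the set of its rational points, with vertex meaning extreme point among them. -}

module Defs where

open import Data.Nat using (ℕ; zero; suc)
open import Data.Fin using (Fin; zero; suc; punchIn; toℕ)
open import Data.Integer as ℤ using (ℤ)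
open import Data.Rational as ℚ using (ℚ; _/_; _≤_; ½)
open import Data.Unit using (⊤)
open import Data.List using (List; []; _∷_)
open import Data.Product using (_×_; _,_; Σ; ∃)
open import Relation.Binary.PropositionalEquality using (_≡_)

Matℤ : ℕ → Set
Matℤ n = Fin n → Fin n → ℤ

Vecℤ : ℕ → Set
Vecℤ n = Fin n → ℤ

Vecℚ : ℕ → Set
Vecℚ n = Fin n → ℚ

toℚ : ℤ → ℚ
toℚ z = z / 1

sumℤ : ∀ {n} → (Fin n → ℤ) → ℤ
sumℤ {zero}  f = ℤ.0ℤ
sumℤ {suc n} f = f zero ℤ.+ sumℤ (λ i → f (suc i))

sumℚ : ∀ {n} → (Fin n → ℚ) → ℚ
sumℚ {zero}  f = ℚ.0ℚ
sumℚ {suc n} f = f zero ℚ.+ sumℚ (λ i → f (suc i))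

prodℚ : ∀ {n} → (Fin n → ℚ) → ℚ
prodℚ {zero}  f = ℚ.1ℚ
prodℚ {suc n} f = f zero ℚ.* prodℚ (λ i → f (suc i))

sign : ℕ → ℤ
sign zero          = ℤ.1ℤ
sign (suc zero)    = ℤ.-1ℤ
sign (suc (suc k)) = sign k

det : ∀ {n} → Matℤ n → ℤ
det {zero}  A = ℤ.1ℤ
det {suc n} A = sumℤ (λ j → sign (toℕ j) ℤ.* (A zero j ℤ.* det (λ r c → A (suc r) (punchIn j c))))

mulℚ : ∀ {n} → Matℤ n → Vecℚ n → Vecℚ n
mulℚ A x i = sumℚ (λ j → toℚ (A i j) ℚ.* x j)

InC : ∀ {n} → Matℤ n → Vecℤ n → Vecℚ n → Set
InC A b x = ∀ i → mulℚ A x i ≤ toℚ (b i)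

combo : ∀ {n} → List (ℚ × Vecℤ n) → Vecℚ n
combo []               i = ℚ.0ℚ
combo ((w , p) ∷ ps) i = w ℚ.* toℚ (p i) ℚ.+ combo ps i

weightSum : ∀ {n} → List (ℚ × Vecℤ n) → ℚ
weightSum []              = ℚ.0ℚ
weightSum ((w , p) ∷ ps) = w ℚ.+ weightSum ps

Admissible : ∀ {n} → Matℤ n → Vecℤ n → List (ℚ × Vecℤ n) → Set
Admissible A b []              = ⊤
Admissible A b ((w , p) ∷ ps) = (ℚ.0ℚ ≤ w) × InC A b (λ i → toℚ (p i)) × Admissible A b ps

-- x ∈ X = conv(C ∩ ℤⁿ)  (rational points; finite convex combinations)
InX : ∀ {n} → Matℤ n → Vecℤ n → Vecℚ n → Set
InX {n} A b x = Σ (List (ℚ × Vecℤ n)) λ ps →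
  Admissible A b ps × weightSum ps ≡ ℚ.1ℚ × (∀ i → combo ps i ≡ x i)

-- v is a vertex (extreme point) of X: v ∈ X, and v is not the midpoint
-- of two distinct points of X
IsVertex : ∀ {n} → Matℤ n → Vecℤ n → Vecℚ n → Set
IsVertex {n} A b v = InX A b v ×
  (∀ (x y : Vecℚ n) → InX A b x → InX A b y →
     (∀ i → v i ≡ ½ ℚ.* (x i ℚ.+ y i)) → ∀ i → x i ≡ y i)

{-# OPTIONS --safe #-}
-- A vertex v of the integer hull is one of the integer points p it is a convex combination of, so
-- μ = b − A p is an integral slack vector. Two distinct points x, y of the box 0 ≤ x ≤ μ cannot be
-- congruent modulo the lattice A ℤⁿ: from x − y = A w we get A (p ± w) ≤ b, and p is the midpoint
-- of p ± w, so w = 0. Hence the ∏ (μᵢ + 1) box points lie in distinct cosets of A ℤⁿ, whose index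
-- is at most |det A|: Euclid's algorithm on adjacent columns clears the first row of A except its
-- first entry g, and then x is classified by x₀ mod g together with (inductively) a coset of the minor.
module Submission where

open import Defs

open import Algebra.Bundles using (CommutativeMonoid)
open import Data.Fin as Fin using (Fin; zero; suc; punchIn; punchOut; toℕ; inject₁; fromℕ; fromℕ<; combine; remQuot)
open import Data.Fin.Induction using (>-weakInduction)
import Data.Fin.Properties as FinP
open import Data.Integer as ℤ using (ℤ; +_; _+_; _*_; -_; _-_; 0ℤ; 1ℤ; ∣_∣)
open import Data.Integer.DivMod using (_/_; _%_; n%d<d; a≡a%n+[a/n]*n)
import Data.Integer.Properties as ℤP
open import Data.Integer.Tactic.RingSolver using (solve-∀)
open import Data.List as List using (List; []; _∷_; _++_)
open import Data.List.Membership.Propositional using (find)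
open import Data.List.Membership.Propositional.Properties using (∈-∃++)
open import Data.List.Relation.Unary.Any using (Any; here; there)
open import Data.Nat as ℕ using (ℕ; zero; suc)
import Data.Nat.Coprimality as Coprime
open import Data.Nat.Induction using (<-wellFounded)
import Data.Nat.Properties as ℕP
open import Data.Product as Product using (∃; _×_; _,_; proj₁; proj₂; uncurry)
open import Data.Rational as ℚ using (ℚ; mkℚ; 0ℚ; 1ℚ; ½)
import Data.Rational.Properties as ℚP
open import Data.Sum using (_⊎_; inj₁; inj₂; [_,_]′)
open import Data.Vec.Functional as Vector using (updateAt)
open import Data.Vec.Functional.Properties using (updateAt-updates; updateAt-minimal)
open import Function using (_∘_; id; const)
open import Induction.WellFounded using (Acc; acc)
open import Level using (0ℓ)
open import Relation.Binary.Construct.Closure.ReflexiveTransitive using (Star; ε; _◅_; _◅◅_; fold)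
open import Relation.Binary.PropositionalEquality
open import Relation.Nullary using (yes; no; contradiction)
open import Relation.Nullary.Decidable using (dec⇒maybe)
import Tactic.RingSolver as RingSolver
open import Tactic.RingSolver.Core.AlmostCommutativeRing using (AlmostCommutativeRing; fromCommutativeRing)

open import Algebra.Properties.CommutativeSemigroup
  (CommutativeMonoid.commutativeSemigroup ℚP.+-0-commutativeMonoid) using (x∙yz≈y∙xz)
open import Algebra.Properties.Group ℚP.+-0-group using (x∙y⁻¹≈ε⇒x≈y)

sumℤ-cong : ∀ {n} {f g : Fin n → ℤ} → (∀ i → f i ≡ g i) → sumℤ f ≡ sumℤ g
sumℤ-cong {zero}  f≗g = refl
sumℤ-cong {suc n} f≗g = cong₂ _+_ (f≗g zero) (sumℤ-cong (f≗g ∘ suc))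

sumℤ-zero : ∀ {n} {f : Fin n → ℤ} → (∀ i → f i ≡ 0ℤ) → sumℤ f ≡ 0ℤ
sumℤ-zero {zero}  f≗0 = refl
sumℤ-zero {suc n} f≗0 = cong₂ _+_ (f≗0 zero) (sumℤ-zero (f≗0 ∘ suc))

sumℤ-linear : ∀ {n} {f g h : Fin n → ℤ} c → (∀ i → f i ≡ g i + c * h i) →
              sumℤ f ≡ sumℤ g + c * sumℤ h
sumℤ-linear {zero}  c _ = sym (trans (ℤP.+-identityˡ _) (ℤP.*-zeroʳ c))
sumℤ-linear {suc n} {f} {g} {h} c f≗ =
  trans (cong₂ _+_ (f≗ zero) (sumℤ-linear c (f≗ ∘ suc)))
        (regroup (g zero) (h zero) (sumℤ (g ∘ suc)) (sumℤ (h ∘ suc)) c)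
  where
  regroup : ∀ a b s t c → a + c * b + (s + c * t) ≡ a + s + c * (b + t)
  regroup = solve-∀

sumℤ-perturb : ∀ {n} {f g : Fin n → ℤ} (k : Fin n) a →
               (∀ j → j ≢ k → g j ≡ f j) → g k ≡ f k + a → sumℤ g ≡ sumℤ f + a
sumℤ-perturb {f = f} zero a g≗f gk =
  trans (cong₂ _+_ gk (sumℤ-cong λ j → g≗f (suc j) λ ())) (swap (f zero) a (sumℤ (f ∘ suc)))
  where
  swap : ∀ x a s → x + a + s ≡ x + s + a
  swap = solve-∀
sumℤ-perturb {f = f} (suc k) a g≗f gk =
  trans (cong₂ _+_ (g≗f zero λ ()) (sumℤ-perturb k a (λ j j≢k → g≗f (suc j) (j≢k ∘ FinP.suc-injective)) gk))
        (sym (ℤP.+-assoc (f zero) (sumℤ (f ∘ suc)) a))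

sumℤ-adjacent : ∀ {n} (f : Fin (suc n) → ℤ) (k : Fin n) →
                (∀ j → j ≢ inject₁ k → j ≢ suc k → f j ≡ 0ℤ) →
                sumℤ f ≡ f (inject₁ k) + f (suc k)
sumℤ-adjacent {suc n} f zero f≗0 =
  trans (cong (λ s → f zero + (f (suc zero) + s)) (sumℤ-zero λ j → f≗0 (suc (suc j)) (λ ()) (λ ())))
        (cong (_+_ (f zero)) (ℤP.+-identityʳ (f (suc zero))))
sumℤ-adjacent {suc n} f (suc k) f≗0 =
  trans (cong₂ _+_ (f≗0 zero (λ ()) (λ ()))
                   (sumℤ-adjacent (f ∘ suc) k λ j p q → f≗0 (suc j) (p ∘ FinP.suc-injective) (q ∘ FinP.suc-injective)))
        (ℤP.+-identityˡ _)

-- Determinants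

minor : ∀ {n} → Fin (suc n) → Matℤ (suc n) → Matℤ n
minor j A r c = A (suc r) (punchIn j c)

laplaceTerm : ∀ {n} → Matℤ (suc n) → Fin (suc n) → ℤ
laplaceTerm A j = sign (toℕ j) * (A zero j * det (minor j A))

det-cong : ∀ {n} (A B : Matℤ n) → (∀ i j → A i j ≡ B i j) → det A ≡ det B
det-cong {zero}  A B A≗B = refl
det-cong {suc n} A B A≗B = sumℤ-cong λ j →
  cong₂ (λ a d → sign (toℕ j) * (a * d)) (A≗B zero j)
        (det-cong (minor j A) (minor j B) λ r c → A≗B (suc r) (punchIn j c))

sign-suc : ∀ t → sign (suc t) ≡ - sign t
sign-suc zero          = refl
sign-suc (suc zero)    = refl
sign-suc (suc (suc t)) = sign-suc t

det-linear-col : ∀ {n} (A B C : Matℤ n) (m : Fin n) c →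
                 (∀ i j → j ≢ m → A i j ≡ B i j) → (∀ i j → j ≢ m → A i j ≡ C i j) →
                 (∀ i → A i m ≡ B i m + c * C i m) → det A ≡ det B + c * det C
det-linear-col {suc n} A B C m c A≗B A≗C Aₘ =
  sumℤ-linear {f = laplaceTerm A} {laplaceTerm B} {laplaceTerm C} c term
  where
  distribˡ : ∀ s b c b′ d → s * ((b + c * b′) * d) ≡ s * (b * d) + c * (s * (b′ * d))
  distribˡ = solve-∀
  distribʳ : ∀ s a c x y → s * (a * (x + c * y)) ≡ s * (a * x) + c * (s * (a * y))
  distribʳ = solve-∀

  punchIn≢ : ∀ {j} (j≢m : j ≢ m) c′ → c′ ≢ punchOut j≢m → punchIn j c′ ≢ m
  punchIn≢ {j} j≢m c′ c′≢ e = c′≢ (FinP.punchIn-injective j c′ _ (trans e (sym (FinP.punchIn-punchOut j≢m))))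

  term : ∀ j → laplaceTerm A j ≡ laplaceTerm B j + c * laplaceTerm C j
  term j with j Fin.≟ m
  ... | yes refl =
    trans (cong₂ (λ a d → s * (a * d)) (Aₘ zero)
                 (det-cong (minor j A) (minor j B) λ r c′ → A≗B (suc r) _ (FinP.punchInᵢ≢i j c′)))
          (trans (distribˡ s (B zero j) c (C zero j) _)
                 (cong (λ d → s * (B zero j * det (minor j B)) + c * (s * (C zero j * d)))
                       (det-cong (minor j B) (minor j C) λ r c′ →
                          trans (sym (A≗B (suc r) _ (FinP.punchInᵢ≢i j c′))) (A≗C (suc r) _ (FinP.punchInᵢ≢i j c′)))))
    where s = sign (toℕ j)
  ... | no j≢m =
    trans (cong (λ d → s * (A zero j * d))
                (det-linear-col (minor j A) (minor j B) (minor j C) (punchOut j≢m) c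
                   (λ i c′ c′≢ → A≗B (suc i) _ (punchIn≢ j≢m c′ c′≢))
                   (λ i c′ c′≢ → A≗C (suc i) _ (punchIn≢ j≢m c′ c′≢))
                   (λ i → subst (λ col → A (suc i) col ≡ B (suc i) col + c * C (suc i) col)
                                (sym (FinP.punchIn-punchOut j≢m)) (Aₘ (suc i)))))
          (trans (distribʳ s (A zero j) c _ _)
                 (cong₂ (λ b b′ → s * (b * det (minor j B)) + c * (s * (b′ * det (minor j C))))
                        (A≗B zero j j≢m) (A≗C zero j j≢m)))
    where s = sign (toℕ j)

punchIn-adjacent : ∀ {n} {X : Set} (g : Fin (suc (suc n)) → X) (k : Fin (suc n)) →
                   g (inject₁ k) ≡ g (suc k) → ∀ c → g (punchIn (inject₁ k) c) ≡ g (punchIn (suc k) c)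
punchIn-adjacent g zero    gₖ zero    = sym gₖ
punchIn-adjacent g zero    gₖ (suc c) = refl
punchIn-adjacent g (suc k) gₖ zero    = refl
punchIn-adjacent {suc n} g (suc k) gₖ (suc c) = punchIn-adjacent (g ∘ suc) k gₖ c

punchIn-adjacent-pair : ∀ {n} (j : Fin (suc (suc n))) (k : Fin (suc n)) → j ≢ inject₁ k → j ≢ suc k →
                        ∃ λ k′ → punchIn j (inject₁ k′) ≡ inject₁ k × punchIn j (suc k′) ≡ suc k
punchIn-adjacent-pair zero             zero    j≢k _    = contradiction refl j≢k
punchIn-adjacent-pair zero             (suc k) _   _    = k , refl , refl
punchIn-adjacent-pair (suc zero)       zero    _   j≢k′ = contradiction refl j≢k′
punchIn-adjacent-pair {suc n} (suc (suc j)) zero _ _    = zero , refl , refl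
punchIn-adjacent-pair {suc n} (suc j)  (suc k) j≢k j≢k′ =
  let k′ , e₁ , e₂ = punchIn-adjacent-pair j k (j≢k ∘ cong suc) (j≢k′ ∘ cong suc)
  in suc k′ , cong suc e₁ , cong suc e₂

det-adjacent-equal : ∀ {n} (A : Matℤ (suc n)) (k : Fin n) →
                     (∀ i → A i (inject₁ k) ≡ A i (suc k)) → det A ≡ 0ℤ
det-adjacent-equal {suc n} A k cols≡ = trans (sumℤ-adjacent (laplaceTerm A) k vanish) cancel
  where
  vanish : ∀ j → j ≢ inject₁ k → j ≢ suc k → laplaceTerm A j ≡ 0ℤ
  vanish j j≢k j≢k′ =
    let k′ , e₁ , e₂ = punchIn-adjacent-pair j k j≢k j≢k′
        minor≡0 = det-adjacent-equal (minor j A) k′ λ i →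
                    trans (cong (A (suc i)) e₁) (trans (cols≡ (suc i)) (cong (A (suc i)) (sym e₂)))
    in trans (cong (λ d → sign (toℕ j) * (A zero j * d)) minor≡0)
             (trans (cong (sign (toℕ j) *_) (ℤP.*-zeroʳ (A zero j))) (ℤP.*-zeroʳ (sign (toℕ j))))

  opposite : ∀ s x → s * x + (- s) * x ≡ 0ℤ
  opposite = solve-∀

  cancel : laplaceTerm A (inject₁ k) + laplaceTerm A (suc k) ≡ 0ℤ
  cancel =
    trans (cong₂ (λ s x → s * x + laplaceTerm A (suc k))
                 (cong sign (FinP.toℕ-inject₁ k))
                 (cong₂ _*_ (cols≡ zero)
                            (det-cong (minor (inject₁ k) A) (minor (suc k) A) λ r →
                               punchIn-adjacent (A (suc r)) k (cols≡ (suc r)))))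
          (trans (cong (λ s → sign (toℕ k) * x + s * x) (sign-suc (toℕ k))) (opposite (sign (toℕ k)) x))
    where x = A zero (suc k) * det (minor (suc k) A)

det-first-row-cleared : ∀ {n} (B : Matℤ (suc n)) → (∀ j → B zero (suc j) ≡ 0ℤ) →
                        det B ≡ B zero zero * det (minor zero B)
det-first-row-cleared B cleared =
  trans (cong (_+_ (laplaceTerm B zero)) (sumℤ-zero λ j →
           trans (cong (λ b → sign (toℕ (suc j)) * (b * det (minor (suc j) B))) (cleared j))
                 (trans (cong (sign (toℕ (suc j)) *_) (ℤP.*-zeroˡ (det (minor (suc j) B))))
                        (ℤP.*-zeroʳ (sign (toℕ (suc j)))))))
        (trans (ℤP.+-identityʳ (laplaceTerm B zero)) (ℤP.*-identityˡ (B zero zero * det (minor zero B))))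

-- Column operations and the lattice A ℤⁿ

addCol : ∀ {n} → Matℤ n → Fin n → Fin n → ℤ → Matℤ n
addCol A m l c i = updateAt (A i) m (_+ c * A i l)

copyCol : ∀ {n} → Matℤ n → Fin n → Fin n → Matℤ n
copyCol A m l i = updateAt (A i) m (const (A i l))

det-addCol : ∀ {n} (A : Matℤ n) m l c → det (copyCol A m l) ≡ 0ℤ → det (addCol A m l c) ≡ det A
det-addCol A m l c copy≡0 =
  trans (det-linear-col (addCol A m l c) A (copyCol A m l) m c
           (λ i j j≢m → updateAt-minimal j m (A i) j≢m)
           (λ i j j≢m → trans (updateAt-minimal j m (A i) j≢m) (sym (updateAt-minimal j m (A i) j≢m)))
           (λ i → trans (updateAt-updates m (A i)) (cong (λ x → A i m + c * x) (sym (updateAt-updates m (A i))))))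
        (trans (cong (λ d → det A + c * d) copy≡0)
               (trans (cong (_+_ (det A)) (ℤP.*-zeroʳ c)) (ℤP.+-identityʳ (det A))))

copyCol-equal : ∀ {n} (A : Matℤ n) {m l} → l ≢ m → ∀ i → copyCol A m l i m ≡ copyCol A m l i l
copyCol-equal A {m} {l} l≢m i = trans (updateAt-updates m (A i)) (sym (updateAt-minimal l m (A i) l≢m))

inject₁≢suc : ∀ {n} (k : Fin n) → inject₁ k ≢ suc k
inject₁≢suc zero    ()
inject₁≢suc (suc k) e = inject₁≢suc k (FinP.suc-injective e)

_·_ : ∀ {n} → Matℤ n → Vecℤ n → Vecℤ n
(A · w) i = sumℤ (λ j → A i j * w j)

infix 4 _∈ℒ_
_∈ℒ_ : ∀ {n} → Vecℤ n → Matℤ n → Set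
d ∈ℒ A = ∃ λ w → ∀ i → (A · w) i ≡ d i

-- (addCol A m l c) w = A w′ for w′ = w + (c wₘ) eₗ
addCol-∈ℒ : ∀ {n} (A : Matℤ n) m l c {d} → d ∈ℒ addCol A m l c → d ∈ℒ A
addCol-∈ℒ {n} A m l c (w , Bw≡d) = w′ , λ i → trans (A·w′≡B·w i) (Bw≡d i)
  where
  w′ : Vecℤ n
  w′ = updateAt w l (_+ c * w m)

  reorder : ∀ a c x → a * (c * x) ≡ c * a * x
  reorder = solve-∀

  A·w′≡B·w : ∀ i → (A · w′) i ≡ (addCol A m l c · w) i
  A·w′≡B·w i =
    trans (sumℤ-perturb l (A i l * (c * w m))
             (λ j j≢l → cong (A i j *_) (updateAt-minimal j l w j≢l))
             (trans (cong (A i l *_) (updateAt-updates l w)) (ℤP.*-distribˡ-+ (A i l) (w l) (c * w m))))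
          (trans (cong (_+_ ((A · w) i)) (reorder (A i l) c (w m)))
                 (sym (sumℤ-perturb m (c * A i l * w m)
                        (λ j j≢m → cong (_* w j) (updateAt-minimal j m (A i) j≢m))
                        (trans (cong (_* w m) (updateAt-updates m (A i))) (ℤP.*-distribʳ-+ (w m) (A i m) (c * A i l))))))

-- det is only shown to be alternating in adjacent columns, so only these operations are used
data AdjColOp {n} (k : Fin n) (A : Matℤ (suc n)) : Matℤ (suc n) → Set where
  addˡ : ∀ c → AdjColOp k A (addCol A (inject₁ k) (suc k) c)
  addʳ : ∀ c → AdjColOp k A (addCol A (suc k) (inject₁ k) c)

infix 4 _↝_
record _↝_ {n} (A B : Matℤ n) : Set where
  constructor mk↝
  field
    det-≡ : det B ≡ det A
    ℒ-⊆   : ∀ {d} → d ∈ℒ B → d ∈ℒ A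

↝-refl : ∀ {n} {A : Matℤ n} → A ↝ A
↝-refl = mk↝ refl id

↝-trans : ∀ {n} {A B C : Matℤ n} → A ↝ B → B ↝ C → A ↝ C
↝-trans (mk↝ detB ℒB⊆ℒA) (mk↝ detC ℒC⊆ℒB) = mk↝ (trans detC detB) (ℒB⊆ℒA ∘ ℒC⊆ℒB)

module _ {n} {k : Fin n} where

  AdjColOp⇒↝ : ∀ {A B} → AdjColOp k A B → A ↝ B
  AdjColOp⇒↝ {A} (addˡ c) =
    mk↝ (det-addCol A (inject₁ k) (suc k) c
           (det-adjacent-equal (copyCol A (inject₁ k) (suc k)) k (copyCol-equal A (inject₁≢suc k ∘ sym))))
        (addCol-∈ℒ A (inject₁ k) (suc k) c)
  AdjColOp⇒↝ {A} (addʳ c) =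
    mk↝ (det-addCol A (suc k) (inject₁ k) c
           (det-adjacent-equal (copyCol A (suc k) (inject₁ k)) k (sym ∘ copyCol-equal A (inject₁≢suc k))))
        (addCol-∈ℒ A (suc k) (inject₁ k) c)

  AdjColOp-outside : ∀ {A B} → AdjColOp k A B → ∀ i j → j ≢ inject₁ k → j ≢ suc k → B i j ≡ A i j
  AdjColOp-outside {A} (addˡ c) i j j≢k _    = updateAt-minimal j _ (A i) j≢k
  AdjColOp-outside {A} (addʳ c) i j _   j≢k′ = updateAt-minimal j _ (A i) j≢k′

  ops⇒↝ : ∀ {A B} → Star (AdjColOp k) A B → A ↝ B
  ops⇒↝ = fold _↝_ (↝-trans ∘ AdjColOp⇒↝) ↝-refl

  ops-outside : ∀ {A B} → Star (AdjColOp k) A B → ∀ i j → j ≢ inject₁ k → j ≢ suc k → B i j ≡ A i j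
  ops-outside = fold (λ A B → ∀ i j → j ≢ inject₁ k → j ≢ suc k → B i j ≡ A i j)
                     (λ op B≗C i j p q → trans (B≗C i j p q) (AdjColOp-outside op i j p q))
                     (λ _ _ _ _ → refl)

module _ {n} (k : Fin n) (r : Fin (suc n)) where

  private
    entries : Matℤ (suc n) → ℤ × ℤ
    entries A = A r (inject₁ k) , A r (suc k)

    entries-addˡ : ∀ A {x y} c → entries A ≡ (x , y) → entries (addCol A (inject₁ k) (suc k) c) ≡ (x + c * y , y)
    entries-addˡ A c e =
      cong₂ _,_ (trans (updateAt-updates (inject₁ k) (A r)) (cong (λ (x , y) → x + c * y) e))
                (trans (updateAt-minimal (suc k) (inject₁ k) (A r) (inject₁≢suc k ∘ sym)) (cong proj₂ e))

    entries-addʳ : ∀ A {x y} c → entries A ≡ (x , y) → entries (addCol A (suc k) (inject₁ k) c) ≡ (x , y + c * x)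
    entries-addʳ A c e =
      cong₂ _,_ (trans (updateAt-minimal (inject₁ k) (suc k) (A r) (inject₁≢suc k)) (cong proj₁ e))
                (trans (updateAt-updates (suc k) (A r)) (cong (λ (x , y) → y + c * x) e))

  -- (a, b) ↦ (a mod b, b) by one column operation, then ↦ (−b, a mod b) by three (a swap up to sign)
  euclid-step : ∀ A {{_ : ℤ.NonZero (A r (suc k))}} →
                ∃ λ B → Star (AdjColOp k) A B × B r (suc k) ≡ + (A r (inject₁ k) % A r (suc k))
  euclid-step A = _ , addˡ (- q) ◅ addʳ 1ℤ ◅ addˡ (- 1ℤ) ◅ addʳ 1ℤ ◅ ε , entry
    where
    a b q : ℤ
    a = A r (inject₁ k)
    b = A r (suc k)
    q = a / b

    A₁ A₂ A₃ : Matℤ (suc n)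
    A₁ = addCol A  (inject₁ k) (suc k) (- q)
    A₂ = addCol A₁ (suc k) (inject₁ k) 1ℤ
    A₃ = addCol A₂ (inject₁ k) (suc k) (- 1ℤ)

    swap : ∀ ρ b → b + 1ℤ * ρ + 1ℤ * (ρ + - 1ℤ * (b + 1ℤ * ρ)) ≡ ρ
    swap = solve-∀
    cancel : ∀ ρ q b → ρ + q * b + - q * b ≡ ρ
    cancel = solve-∀

    entry : addCol A₃ (suc k) (inject₁ k) 1ℤ r (suc k) ≡ + (a % b)
    entry = trans (cong proj₂ (entries-addʳ A₃ 1ℤ (entries-addˡ A₂ (- 1ℤ)
                                 (entries-addʳ A₁ 1ℤ (entries-addˡ A (- q) refl)))))
                  (trans (swap (a + - q * b) b)
                         (trans (cong (_+ - q * b) (a≡a%n+[a/n]*n a b)) (cancel (+ (a % b)) q b)))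

  clear-entry : ∀ A → Acc ℕ._<_ ∣ A r (suc k) ∣ → ∃ λ B → Star (AdjColOp k) A B × B r (suc k) ≡ 0ℤ
  clear-entry A (acc smaller) with A r (suc k) ℤP.≟ 0ℤ
  ... | yes b≡0 = A , ε , b≡0
  ... | no  b≢0 = descend {{ℤ.≢-nonZero b≢0}}
    where
    descend : {{_ : ℤ.NonZero (A r (suc k))}} → ∃ λ B → Star (AdjColOp k) A B × B r (suc k) ≡ 0ℤ
    descend =
      let B , ops , Bₖ≡ρ = euclid-step A
          smaller-entry : ∣ B r (suc k) ∣ ℕ.< ∣ A r (suc k) ∣
          smaller-entry = subst (ℕ._< ∣ A r (suc k) ∣) (sym (cong ∣_∣ Bₖ≡ρ)) (n%d<d (A r (inject₁ k)) (A r (suc k)))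
          C , ops′ , Cₖ≡0 = clear-entry B (smaller smaller-entry)
      in C , ops ◅◅ ops′ , Cₖ≡0

inject₁<⇒≡suc⊎suc< : ∀ {n} {k : Fin n} {j : Fin (suc n)} → inject₁ k Fin.< j → j ≡ suc k ⊎ suc k Fin.< j
inject₁<⇒≡suc⊎suc< {k = k} {j} k<j
  with ℕP.m≤n⇒m<n∨m≡n (subst (λ t → suc t ℕ.≤ toℕ j) (FinP.toℕ-inject₁ k) k<j)
... | inj₁ k+1<j = inj₂ k+1<j
... | inj₂ k+1≡j = inj₁ (FinP.toℕ-injective (sym k+1≡j))

-- columns are cleared from the right: clearing column k+1 against column k leaves those beyond alone
clear-first-row : ∀ {n} (A : Matℤ (suc n)) → ∃ λ B → A ↝ B × ∀ j → B zero (suc j) ≡ 0ℤ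
clear-first-row {n} A =
  let B , A↝B , cleared = >-weakInduction ClearedAfter base step zero
  in B , A↝B , λ j → cleared (suc j) ℕ.z<s
  where
  ClearedAfter : Fin (suc n) → Set
  ClearedAfter t = ∃ λ B → A ↝ B × ∀ j → t Fin.< j → B zero j ≡ 0ℤ

  base : ClearedAfter (fromℕ n)
  base = A , ↝-refl , λ j n<j → contradiction (FinP.≤fromℕ j) (ℕP.<⇒≱ n<j)

  step : ∀ k → ClearedAfter (suc k) → ClearedAfter (inject₁ k)
  step k (B , A↝B , cleared) =
    let C , ops , Cₖ≡0 = clear-entry k zero B (<-wellFounded _) in
    C , ↝-trans A↝B (ops⇒↝ ops) , λ j k<j → [ (λ { refl → Cₖ≡0 }) ,
      (λ k+1<j → trans (ops-outside ops zero j (FinP.<⇒≢ k<j ∘ sym) (FinP.<⇒≢ k+1<j ∘ sym)) (cleared j k+1<j)) ]′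
      (inject₁<⇒≡suc⊎suc< k<j)

-- The index of A ℤⁿ

-- a labelling of ℤⁿ by Fin k whose fibres lie in cosets of ℒ A, i.e. [ℤⁿ : ℒ A] ≤ k
IndexAtMost : ∀ {n} → Matℤ n → ℕ → Set
IndexAtMost {n} A k = ∃ λ (label : Vecℤ n → Fin k) → ∀ x y → label x ≡ label y → (λ i → x i - y i) ∈ℒ A

-- x is labelled by x₀ mod g, where g = B₀₀, and by the label of the tail of x − ⌊x₀/g⌋ · (column 0 of B)
index-first-row-cleared : ∀ {n} (B : Matℤ (suc n)) {{_ : ℤ.NonZero (B zero zero)}} {k} →
                          (∀ j → B zero (suc j) ≡ 0ℤ) → IndexAtMost (minor zero B) k →
                          IndexAtMost B (∣ B zero zero ∣ ℕ.* k)
index-first-row-cleared {n} B {k} cleared (labelM , soundM) = label , sound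
  where
  g : ℤ
  g = B zero zero

  q : Vecℤ (suc n) → ℤ
  q x = x zero / g

  rest : Vecℤ (suc n) → Vecℤ n
  rest x i = x (suc i) - q x * B (suc i) zero

  residue : Vecℤ (suc n) → Fin ∣ g ∣
  residue x = fromℕ< (n%d<d (x zero) g)

  label : Vecℤ (suc n) → Fin (∣ g ∣ ℕ.* k)
  label x = combine (residue x) (labelM (rest x))

  row₀ : ∀ ρ a b g → ρ + a * g - (ρ + b * g) ≡ g * (a - b) + 0ℤ
  row₀ = solve-∀
  rowᵢ : ∀ c a b x y → c * (a - b) + (x - a * c - (y - b * c)) ≡ x - y
  rowᵢ = solve-∀

  sound : ∀ x y → label x ≡ label y → (λ i → x i - y i) ∈ℒ B
  sound x y lx≡ly with FinP.combine-injective (residue x) (labelM (rest x)) (residue y) (labelM (rest y)) lx≡ly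
  ... | residue≡ , labelM≡ with soundM (rest x) (rest y) labelM≡
  ... | w , Mw≡ = (q x - q y) Vector.∷ w , row
    where
    r≡ : x zero % g ≡ y zero % g
    r≡ = trans (sym (FinP.toℕ-fromℕ< (n%d<d (x zero) g)))
               (trans (cong toℕ residue≡) (FinP.toℕ-fromℕ< (n%d<d (y zero) g)))

    row : ∀ i → (B · ((q x - q y) Vector.∷ w)) i ≡ x i - y i
    row zero = begin
      g * (q x - q y) + sumℤ (λ j → B zero (suc j) * w j)
        ≡⟨ cong (_+_ (g * (q x - q y))) (sumℤ-zero λ j → trans (cong (_* w j) (cleared j)) (ℤP.*-zeroˡ (w j))) ⟩
      g * (q x - q y) + 0ℤ
        ≡⟨ row₀ (+ (x zero % g)) (q x) (q y) g ⟨
      + (x zero % g) + q x * g - (+ (x zero % g) + q y * g)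
        ≡⟨ cong₂ _-_ (a≡a%n+[a/n]*n (x zero) g)
                     (trans (a≡a%n+[a/n]*n (y zero) g) (cong (λ r → + r + q y * g) (sym r≡))) ⟨
      x zero - y zero ∎
      where open ≡-Reasoning
    row (suc i) = trans (cong (_+_ (B (suc i) zero * (q x - q y))) (Mw≡ i))
                        (rowᵢ (B (suc i) zero) (q x) (q y) (x (suc i)) (y (suc i)))

IndexAtMost-⊆ : ∀ {n k} {A B : Matℤ n} → (∀ {d} → d ∈ℒ B → d ∈ℒ A) → IndexAtMost B k → IndexAtMost A k
IndexAtMost-⊆ ℒB⊆ℒA (label , sound) = label , λ x y lx≡ly → ℒB⊆ℒA (sound x y lx≡ly)

index≤∣det∣ : ∀ {n} (A : Matℤ n) → det A ≢ 0ℤ → IndexAtMost A ∣ det A ∣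
index≤∣det∣ {zero}  A _ = (λ _ → zero) , λ _ _ _ → (λ ()) , λ ()
index≤∣det∣ {suc n} A detA≢0 with clear-first-row A
... | B , mk↝ detB≡detA ℒB⊆ℒA , cleared =
  subst (IndexAtMost A) ∣g∣*∣detM∣≡∣detA∣ (IndexAtMost-⊆ {A = A} {B} ℒB⊆ℒA indexB)
  where
  g : ℤ
  g = B zero zero
  M : Matℤ n
  M = minor zero B

  detA≡ : det A ≡ g * det M
  detA≡ = trans (sym detB≡detA) (det-first-row-cleared B cleared)

  g≢0 : g ≢ 0ℤ
  g≢0 g≡0 = detA≢0 (trans detA≡ (trans (cong (_* det M) g≡0) (ℤP.*-zeroˡ (det M))))

  detM≢0 : det M ≢ 0ℤ
  detM≢0 detM≡0 = detA≢0 (trans detA≡ (trans (cong (g *_) detM≡0) (ℤP.*-zeroʳ g)))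

  ∣g∣*∣detM∣≡∣detA∣ : ∣ g ∣ ℕ.* ∣ det M ∣ ≡ ∣ det A ∣
  ∣g∣*∣detM∣≡∣detA∣ = trans (sym (ℤP.abs-* g (det M))) (cong ∣_∣ (sym detA≡))

  indexB : IndexAtMost B (∣ g ∣ ℕ.* ∣ det M ∣)
  indexB = index-first-row-cleared B {{ℤ.≢-nonZero g≢0}} cleared (index≤∣det∣ M detM≢0)

ℚ-ring : AlmostCommutativeRing 0ℓ 0ℓ
ℚ-ring = fromCommutativeRing ℚP.+-*-commutativeRing (λ x → dec⇒maybe (0ℚ ℚP.≟ x))

-- rewriting the normalised z / 1 to this normal form makes +, * and ≤ on such numbers compute
toℚ≡mkℚ : ∀ z → toℚ z ≡ mkℚ z 0 (Coprime.sym (Coprime.1-coprimeTo _))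
toℚ≡mkℚ z = ℚP.↥p/↧p≡p (mkℚ z 0 (Coprime.sym (Coprime.1-coprimeTo _)))

toℚ-+ : ∀ a b → toℚ (a + b) ≡ toℚ a ℚ.+ toℚ b
toℚ-+ a b rewrite toℚ≡mkℚ a | toℚ≡mkℚ b =
  cong (ℚ._/ 1) (sym (cong₂ _+_ (ℤP.*-identityʳ a) (ℤP.*-identityʳ b)))

toℚ-* : ∀ a b → toℚ (a * b) ≡ toℚ a ℚ.* toℚ b
toℚ-* a b rewrite toℚ≡mkℚ a | toℚ≡mkℚ b = refl

toℚ-mono-≤ : ∀ {a b} → a ℤ.≤ b → toℚ a ℚ.≤ toℚ b
toℚ-mono-≤ {a} {b} a≤b rewrite toℚ≡mkℚ a | toℚ≡mkℚ b =
  ℚ.*≤* (subst₂ ℤ._≤_ (sym (ℤP.*-identityʳ a)) (sym (ℤP.*-identityʳ b)) a≤b)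

toℚ-cancel-≤ : ∀ {a b} → toℚ a ℚ.≤ toℚ b → a ℤ.≤ b
toℚ-cancel-≤ {a} {b} a≤b rewrite toℚ≡mkℚ a | toℚ≡mkℚ b =
  subst₂ ℤ._≤_ (ℤP.*-identityʳ a) (ℤP.*-identityʳ b) (ℚP.drop-*≤* a≤b)

toℚ-injective : ∀ {a b} → toℚ a ≡ toℚ b → a ≡ b
toℚ-injective a≡b =
  ℤP.≤-antisym (toℚ-cancel-≤ (ℚP.≤-reflexive a≡b)) (toℚ-cancel-≤ (ℚP.≤-reflexive (sym a≡b)))

sumℚ-toℚ : ∀ {n} (f : Fin n → ℤ) → sumℚ (toℚ ∘ f) ≡ toℚ (sumℤ f)
sumℚ-toℚ {zero}  f = refl
sumℚ-toℚ {suc n} f = trans (cong (toℚ (f zero) ℚ.+_) (sumℚ-toℚ (f ∘ suc))) (sym (toℚ-+ (f zero) (sumℤ (f ∘ suc))))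

sumℚ-cong : ∀ {n} {f g : Fin n → ℚ} → (∀ i → f i ≡ g i) → sumℚ f ≡ sumℚ g
sumℚ-cong {zero}  f≗g = refl
sumℚ-cong {suc n} f≗g = cong₂ ℚ._+_ (f≗g zero) (sumℚ-cong (f≗g ∘ suc))

mulℚ-cong : ∀ {n} (A : Matℤ n) {x y : Vecℚ n} → (∀ j → x j ≡ y j) → ∀ i → mulℚ A x i ≡ mulℚ A y i
mulℚ-cong A x≗y i = sumℚ-cong λ j → cong (toℚ (A i j) ℚ.*_) (x≗y j)

mulℚ-toℚ : ∀ {n} (A : Matℤ n) (p : Vecℤ n) i → mulℚ A (toℚ ∘ p) i ≡ toℚ ((A · p) i)
mulℚ-toℚ A p i = trans (sumℚ-cong λ j → sym (toℚ-* (A i j) (p j))) (sumℚ-toℚ λ j → A i j * p j)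

∏ : ∀ {n} → (Fin n → ℕ) → ℕ
∏ {zero}  m = 1
∏ {suc n} m = m zero ℕ.* ∏ (m ∘ suc)

prodℚ-cong : ∀ {n} {f g : Fin n → ℚ} → (∀ i → f i ≡ g i) → prodℚ f ≡ prodℚ g
prodℚ-cong {zero}  f≗g = refl
prodℚ-cong {suc n} f≗g = cong₂ ℚ._*_ (f≗g zero) (prodℚ-cong (f≗g ∘ suc))

prodℚ-toℚ : ∀ {n} (m : Fin n → ℕ) → prodℚ (λ i → toℚ (+ m i)) ≡ toℚ (+ ∏ m)
prodℚ-toℚ {zero}  m = refl
prodℚ-toℚ {suc n} m =
  trans (cong (toℚ (+ m zero) ℚ.*_) (prodℚ-toℚ (m ∘ suc)))
        (trans (sym (toℚ-* (+ m zero) (+ ∏ (m ∘ suc)))) (cong toℚ (sym (ℤP.pos-* (m zero) (∏ (m ∘ suc))))))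

-- The integer hull

scale : ∀ {n} → ℚ → List (ℚ × Vecℤ n) → List (ℚ × Vecℤ n)
scale c = List.map (Product.map₁ (c ℚ.*_))

combo-scale : ∀ {n} c (L : List (ℚ × Vecℤ n)) i → combo (scale c L) i ≡ c ℚ.* combo L i
combo-scale c []            i = sym (ℚP.*-zeroʳ c)
combo-scale c ((w , p) ∷ L) i =
  trans (cong (ℚ._+_ (c ℚ.* w ℚ.* toℚ (p i))) (combo-scale c L i)) (factor c w (toℚ (p i)) (combo L i))
  where
  factor : ∀ c w x y → c ℚ.* w ℚ.* x ℚ.+ c ℚ.* y ≡ c ℚ.* (w ℚ.* x ℚ.+ y)
  factor = RingSolver.solve-∀ ℚ-ring

weightSum-scale : ∀ {n} c (L : List (ℚ × Vecℤ n)) → weightSum (scale c L) ≡ c ℚ.* weightSum L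
weightSum-scale c []            = sym (ℚP.*-zeroʳ c)
weightSum-scale c ((w , p) ∷ L) =
  trans (cong (ℚ._+_ (c ℚ.* w)) (weightSum-scale c L)) (sym (ℚP.*-distribˡ-+ c w (weightSum L)))

combo-extract : ∀ {n} (pre : List (ℚ × Vecℤ n)) {w p} post i →
                combo (pre ++ (w , p) ∷ post) i ≡ w ℚ.* toℚ (p i) ℚ.+ combo (pre ++ post) i
combo-extract []               post i = refl
combo-extract ((w′ , p′) ∷ pre) {w} {p} post i =
  trans (cong (ℚ._+_ (w′ ℚ.* toℚ (p′ i))) (combo-extract pre post i))
        (x∙yz≈y∙xz (w′ ℚ.* toℚ (p′ i)) (w ℚ.* toℚ (p i)) (combo (pre ++ post) i))

weightSum-extract : ∀ {n} (pre : List (ℚ × Vecℤ n)) {w p} post →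
                    weightSum (pre ++ (w , p) ∷ post) ≡ w ℚ.+ weightSum (pre ++ post)
weightSum-extract []               post = refl
weightSum-extract ((w′ , p′) ∷ pre) {w} post =
  trans (cong (ℚ._+_ w′) (weightSum-extract pre post)) (x∙yz≈y∙xz w′ w (weightSum (pre ++ post)))

0≤* : ∀ {p q} → 0ℚ ℚ.≤ p → 0ℚ ℚ.≤ q → 0ℚ ℚ.≤ p ℚ.* q
0≤* {p} {q} 0≤p 0≤q =
  ℚP.nonNegative⁻¹ _ {{ℚP.nonNeg*nonNeg⇒nonNeg p {{ℚ.nonNegative 0≤p}} q {{ℚ.nonNegative 0≤q}}}}

module _ {n} (A : Matℤ n) (b : Vecℤ n) where

  Admissible-scale : ∀ {c} L → 0ℚ ℚ.≤ c → Admissible A b L → Admissible A b (scale c L)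
  Admissible-scale []      0≤c _                  = _
  Admissible-scale (_ ∷ L) 0≤c (0≤w , p∈C , admL) = 0≤* 0≤c 0≤w , p∈C , Admissible-scale L 0≤c admL

  Admissible-extract : ∀ pre {w p} post → Admissible A b (pre ++ (w , p) ∷ post) →
                       (0ℚ ℚ.≤ w × InC A b (toℚ ∘ p)) × Admissible A b (pre ++ post)
  Admissible-extract []        post (0≤w , p∈C , adm)    = (0≤w , p∈C) , adm
  Admissible-extract (_ ∷ pre) post (0≤w′ , p′∈C , adm) =
    Product.map₂ (λ adm′ → 0≤w′ , p′∈C , adm′) (Admissible-extract pre post adm)

  weightSum-nonneg : ∀ L → Admissible A b L → 0ℚ ℚ.≤ weightSum L
  weightSum-nonneg []      _                = ℚP.≤-refl
  weightSum-nonneg (_ ∷ L) (0≤w , _ , admL) = ℚP.+-mono-≤ 0≤w (weightSum-nonneg L admL)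

nonzero-weight : ∀ {n} (L : List (ℚ × Vecℤ n)) → weightSum L ≢ 0ℚ → Any ((_≢ 0ℚ) ∘ proj₁) L
nonzero-weight []            ΣL≢0 = contradiction refl ΣL≢0
nonzero-weight ((w , p) ∷ L) ΣL≢0 with w ℚP.≟ 0ℚ
... | no  w≢0  = here w≢0
... | yes refl = there (nonzero-weight L (ΣL≢0 ∘ trans (ℚP.+-identityˡ (weightSum L))))

*-zero-cancelˡ : ∀ a {c} → a ≢ 0ℚ → a ℚ.* c ≡ 0ℚ → c ≡ 0ℚ
*-zero-cancelˡ a {c} a≢0 ac≡0 = begin
  c                 ≡⟨ ℚP.*-identityˡ c ⟨
  1ℚ ℚ.* c          ≡⟨ cong (ℚ._* c) (ℚP.*-inverseˡ a) ⟨
  a⁻¹ ℚ.* a ℚ.* c   ≡⟨ ℚP.*-assoc a⁻¹ a c ⟩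
  a⁻¹ ℚ.* (a ℚ.* c) ≡⟨ cong (a⁻¹ ℚ.*_) ac≡0 ⟩
  a⁻¹ ℚ.* 0ℚ        ≡⟨ ℚP.*-zeroʳ a⁻¹ ⟩
  0ℚ                ∎
  where
  open ≡-Reasoning
  instance
    nonZero : ℚ.NonZero a
    nonZero = ℚ.≢-nonZero a≢0
  a⁻¹ : ℚ
  a⁻¹ = ℚ.1/ a

-- v = w p + R is the midpoint of v ± w (v − p), and both are convex combinations of p and the points of R
atom-of-vertex : ∀ {n} (A : Matℤ n) (b : Vecℤ n) {v : Vecℚ n} → IsVertex A b v →
                 ∀ {w p} (R : List (ℚ × Vecℤ n)) → w ≢ 0ℚ → 0ℚ ℚ.≤ w → InC A b (toℚ ∘ p) →
                 Admissible A b R → w ℚ.+ weightSum R ≡ 1ℚ →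
                 (∀ i → w ℚ.* toℚ (p i) ℚ.+ combo R i ≡ v i) → ∀ i → toℚ (p i) ≡ v i
atom-of-vertex {n} A b {v} (_ , extreme) {w} {p} R w≢0 0≤w p∈C admR w+ΣR≡1 wp+R≡v i =
  sym (x∙y⁻¹≈ε⇒x≈y (v i) (toℚ (p i)) (*-zero-cancelˡ (w ℚ.+ w) 2w≢0 (begin
    (w ℚ.+ w) ℚ.* (v i ℚ.- toℚ (p i))
      ≡⟨ cong (λ vᵢ → (w ℚ.+ w) ℚ.* (vᵢ ℚ.- toℚ (p i))) (wp+R≡v i) ⟨
    (w ℚ.+ w) ℚ.* (w ℚ.* toℚ (p i) ℚ.+ combo R i ℚ.- toℚ (p i))
      ≡⟨ difference w (toℚ (p i)) (combo R i) ⟨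
    (w ℚ.* w ℚ.* toℚ (p i) ℚ.+ (1ℚ ℚ.+ w) ℚ.* combo R i)
      ℚ.- (w ℚ.* (1ℚ ℚ.+ (1ℚ ℚ.- w)) ℚ.* toℚ (p i) ℚ.+ (1ℚ ℚ.- w) ℚ.* combo R i)
      ≡⟨ cong₂ ℚ._-_ (x≡ i) (y≡ i) ⟨
    x i ℚ.- y i
      ≡⟨ cong (ℚ._- y i) (extreme x y x∈X y∈X midpoint i) ⟩
    y i ℚ.- y i
      ≡⟨ ℚP.+-inverseʳ (y i) ⟩
    0ℚ ∎)))
  where
  open ≡-Reasoning

  ΣR≡1-w : weightSum R ≡ 1ℚ ℚ.- w
  ΣR≡1-w = trans (cancel w (weightSum R)) (cong (ℚ._- w) w+ΣR≡1)
    where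
    cancel : ∀ w u → u ≡ w ℚ.+ u ℚ.- w
    cancel = RingSolver.solve-∀ ℚ-ring

  0≤1-w : 0ℚ ℚ.≤ 1ℚ ℚ.- w
  0≤1-w = subst (0ℚ ℚ.≤_) ΣR≡1-w (weightSum-nonneg A b R admR)

  0≤1+w : 0ℚ ℚ.≤ 1ℚ ℚ.+ w
  0≤1+w = ℚP.+-mono-≤ (ℚP.nonNegative⁻¹ 1ℚ) 0≤w

  xs ys : List (ℚ × Vecℤ n)
  xs = (w ℚ.* w , p) ∷ scale (1ℚ ℚ.+ w) R
  ys = (w ℚ.* (1ℚ ℚ.+ (1ℚ ℚ.- w)) , p) ∷ scale (1ℚ ℚ.- w) R

  x y : Vecℚ n
  x = combo xs
  y = combo ys

  x∈X : InX A b x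
  x∈X = xs , (0≤* 0≤w 0≤w , p∈C , Admissible-scale A b R 0≤1+w admR) ,
        trans (cong (ℚ._+_ (w ℚ.* w)) (trans (weightSum-scale (1ℚ ℚ.+ w) R) (cong ((1ℚ ℚ.+ w) ℚ.*_) ΣR≡1-w)))
              (total w) ,
        λ _ → refl
    where
    total : ∀ w → w ℚ.* w ℚ.+ (1ℚ ℚ.+ w) ℚ.* (1ℚ ℚ.- w) ≡ 1ℚ
    total = RingSolver.solve-∀ ℚ-ring

  y∈X : InX A b y
  y∈X = ys , (0≤* 0≤w (ℚP.+-mono-≤ (ℚP.nonNegative⁻¹ 1ℚ) 0≤1-w) , p∈C , Admissible-scale A b R 0≤1-w admR) ,
        trans (cong (ℚ._+_ (w ℚ.* (1ℚ ℚ.+ (1ℚ ℚ.- w))))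
                    (trans (weightSum-scale (1ℚ ℚ.- w) R) (cong ((1ℚ ℚ.- w) ℚ.*_) ΣR≡1-w)))
              (total w) ,
        λ _ → refl
    where
    total : ∀ w → w ℚ.* (1ℚ ℚ.+ (1ℚ ℚ.- w)) ℚ.+ (1ℚ ℚ.- w) ℚ.* (1ℚ ℚ.- w) ≡ 1ℚ
    total = RingSolver.solve-∀ ℚ-ring

  x≡ : ∀ i → x i ≡ w ℚ.* w ℚ.* toℚ (p i) ℚ.+ (1ℚ ℚ.+ w) ℚ.* combo R i
  x≡ i = cong (ℚ._+_ (w ℚ.* w ℚ.* toℚ (p i))) (combo-scale (1ℚ ℚ.+ w) R i)

  y≡ : ∀ i → y i ≡ w ℚ.* (1ℚ ℚ.+ (1ℚ ℚ.- w)) ℚ.* toℚ (p i) ℚ.+ (1ℚ ℚ.- w) ℚ.* combo R i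
  y≡ i = cong (ℚ._+_ (w ℚ.* (1ℚ ℚ.+ (1ℚ ℚ.- w)) ℚ.* toℚ (p i))) (combo-scale (1ℚ ℚ.- w) R i)

  midpoint : ∀ i → v i ≡ ½ ℚ.* (x i ℚ.+ y i)
  midpoint i = trans (sym (wp+R≡v i))
                     (trans (average w (toℚ (p i)) (combo R i)) (sym (cong₂ (λ s t → ½ ℚ.* (s ℚ.+ t)) (x≡ i) (y≡ i))))
    where
    average : ∀ w P R → w ℚ.* P ℚ.+ R ≡ ½ ℚ.* ((w ℚ.* w ℚ.* P ℚ.+ (1ℚ ℚ.+ w) ℚ.* R)
                                               ℚ.+ (w ℚ.* (1ℚ ℚ.+ (1ℚ ℚ.- w)) ℚ.* P ℚ.+ (1ℚ ℚ.- w) ℚ.* R))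
    average = RingSolver.solve-∀ ℚ-ring

  difference : ∀ w P R → (w ℚ.* w ℚ.* P ℚ.+ (1ℚ ℚ.+ w) ℚ.* R)
                           ℚ.- (w ℚ.* (1ℚ ℚ.+ (1ℚ ℚ.- w)) ℚ.* P ℚ.+ (1ℚ ℚ.- w) ℚ.* R)
                         ≡ (w ℚ.+ w) ℚ.* (w ℚ.* P ℚ.+ R ℚ.- P)
  difference = RingSolver.solve-∀ ℚ-ring

  2w≢0 : w ℚ.+ w ≢ 0ℚ
  2w≢0 2w≡0 = w≢0 (trans (half w) (trans (cong (½ ℚ.*_) 2w≡0) (ℚP.*-zeroʳ ½)))
    where
    half : ∀ w → w ≡ ½ ℚ.* (w ℚ.+ w)
    half = RingSolver.solve-∀ ℚ-ring

vertex-integral : ∀ {n} (A : Matℤ n) (b : Vecℤ n) (v : Vecℚ n) → IsVertex A b v →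
                  ∃ λ p → InC A b (toℚ ∘ p) × ∀ i → toℚ (p i) ≡ v i
vertex-integral A b v vertex@((L , admL , ΣL≡1 , L≗v) , _)
  with find (nonzero-weight L λ ΣL≡0 → contradiction (trans (sym ΣL≡1) ΣL≡0) λ ())
... | (w , p) , e∈L , w≢0 with ∈-∃++ e∈L
... | pre , post , refl with Admissible-extract A b pre post admL
... | (0≤w , p∈C) , admR =
  p , p∈C , atom-of-vertex A b vertex {w} {p} (pre ++ post) w≢0 0≤w p∈C admR
              (trans (sym (weightSum-extract pre post)) ΣL≡1)
              (λ i → trans (sym (combo-extract pre post i)) (L≗v i))

-- The slack box

·-distrib-+ : ∀ {n} (A : Matℤ n) (p w : Vecℤ n) i → (A · (λ j → p j + w j)) i ≡ (A · p) i + (A · w) i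
·-distrib-+ A p w i =
  trans (sumℤ-linear 1ℤ λ j → expand (A i j) (p j) (w j)) (cong (_+_ ((A · p) i)) (ℤP.*-identityˡ ((A · w) i)))
  where
  expand : ∀ a x y → a * (x + y) ≡ a * x + 1ℤ * (a * y)
  expand = solve-∀

·-distrib-- : ∀ {n} (A : Matℤ n) (p w : Vecℤ n) i → (A · (λ j → p j - w j)) i ≡ (A · p) i - (A · w) i
·-distrib-- A p w i =
  trans (sumℤ-linear (- 1ℤ) λ j → expand (A i j) (p j) (w j)) (negate ((A · p) i) ((A · w) i))
  where
  expand : ∀ a x y → a * (x - y) ≡ a * x + - 1ℤ * (a * y)
  expand = solve-∀
  negate : ∀ s t → s + - 1ℤ * t ≡ s - t
  negate = solve-∀

InC-integral : ∀ {n} (A : Matℤ n) (b q : Vecℤ n) → (∀ i → (A · q) i ℤ.≤ b i) → InC A b (toℚ ∘ q)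
InC-integral A b q Aq≤b i = subst (ℚ._≤ toℚ (b i)) (sym (mulℚ-toℚ A q i)) (toℚ-mono-≤ (Aq≤b i))

InC⇒InX : ∀ {n} (A : Matℤ n) (b q : Vecℤ n) → InC A b (toℚ ∘ q) → InX A b (toℚ ∘ q)
InC⇒InX A b q q∈C =
  (1ℚ , q) ∷ [] , (ℚP.nonNegative⁻¹ 1ℚ , q∈C , _) , ℚP.+-identityʳ 1ℚ ,
  λ i → trans (ℚP.+-identityʳ (1ℚ ℚ.* toℚ (q i))) (ℚP.*-identityˡ (toℚ (q i)))

vertex-rigid : ∀ {n} (A : Matℤ n) (b : Vecℤ n) {v} {p w : Vecℤ n} → IsVertex A b v → (∀ i → toℚ (p i) ≡ v i) →
               (∀ i → (A · (λ j → p j + w j)) i ℤ.≤ b i) → (∀ i → (A · (λ j → p j - w j)) i ℤ.≤ b i) →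
               ∀ i → w i ≡ 0ℤ
vertex-rigid {n} A b {v} {p} {w} (_ , extreme) p≗v p+w∈C p-w∈C i =
  ℤP.*-cancelˡ-≡ (+ 2) (w i) 0ℤ (trans (double (p i) (w i))
    (trans (cong (_- (p i - w i)) p+w≡p-w) (ℤP.+-inverseʳ (p i - w i))))
  where
  p+w p-w : Vecℤ n
  p+w j = p j + w j
  p-w j = p j - w j

  double : ∀ p w → + 2 * w ≡ p + w - (p - w)
  double = solve-∀
  balance : ∀ p w → p + p ≡ p + w + (p - w)
  balance = solve-∀
  half : ∀ x → x ≡ ½ ℚ.* (x ℚ.+ x)
  half = RingSolver.solve-∀ ℚ-ring

  midpoint : ∀ i → v i ≡ ½ ℚ.* (toℚ (p i + w i) ℚ.+ toℚ (p i - w i))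
  midpoint i = begin
    v i                                          ≡⟨ p≗v i ⟨
    toℚ (p i)                                    ≡⟨ half (toℚ (p i)) ⟩
    ½ ℚ.* (toℚ (p i) ℚ.+ toℚ (p i))              ≡⟨ cong (½ ℚ.*_) (toℚ-+ (p i) (p i)) ⟨
    ½ ℚ.* toℚ (p i + p i)                        ≡⟨ cong (λ z → ½ ℚ.* toℚ z) (balance (p i) (w i)) ⟩
    ½ ℚ.* toℚ (p i + w i + (p i - w i))          ≡⟨ cong (½ ℚ.*_) (toℚ-+ (p i + w i) (p i - w i)) ⟩
    ½ ℚ.* (toℚ (p i + w i) ℚ.+ toℚ (p i - w i))  ∎
    where open ≡-Reasoning

  p+w≡p-w : p i + w i ≡ p i - w i
  p+w≡p-w = toℚ-injective (extreme _ _ (InC⇒InX A b p+w (InC-integral A b p+w p+w∈C))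
                                       (InC⇒InX A b p-w (InC-integral A b p-w p-w∈C)) midpoint i)

-- the mixed-radix digits of t
unpack : ∀ {n} (m : Fin n → ℕ) → Fin (∏ m) → (i : Fin n) → Fin (m i)
unpack {suc n} m t zero    = proj₁ (remQuot {m zero} (∏ (m ∘ suc)) t)
unpack {suc n} m t (suc i) = unpack (m ∘ suc) (proj₂ (remQuot {m zero} (∏ (m ∘ suc)) t)) i

unpack-injective : ∀ {n} (m : Fin n → ℕ) {t t′} → (∀ i → unpack m t i ≡ unpack m t′ i) → t ≡ t′
unpack-injective {zero}  m {zero} {zero} _ = refl
unpack-injective {suc n} m {t} {t′} t≗t′ = begin
  t                                                   ≡⟨ FinP.combine-remQuot {m zero} (∏ (m ∘ suc)) t ⟨
  uncurry combine (remQuot {m zero} (∏ (m ∘ suc)) t)  ≡⟨ cong (uncurry combine) (cong₂ _,_ (t≗t′ zero) rest≡) ⟩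
  uncurry combine (remQuot {m zero} (∏ (m ∘ suc)) t′) ≡⟨ FinP.combine-remQuot {m zero} (∏ (m ∘ suc)) t′ ⟩
  t′                                                  ∎
  where
  open ≡-Reasoning
  rest≡ : proj₂ (remQuot {m zero} (∏ (m ∘ suc)) t) ≡ proj₂ (remQuot {m zero} (∏ (m ∘ suc)) t′)
  rest≡ = unpack-injective (m ∘ suc) (t≗t′ ∘ suc)

-- equal labels of box points x, y give x − y = A w with A (p ± w) ≤ b, so w = 0 as p is a vertex
box≤index : ∀ {n} (A : Matℤ n) (b : Vecℤ n) {v} (p : Vecℤ n) (s : Fin n → ℕ) {k} →
            IsVertex A b v → (∀ i → toℚ (p i) ≡ v i) → (∀ i → (A · p) i + + s i ≡ b i) →
            IndexAtMost A k → ∏ (suc ∘ s) ℕ.≤ k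
box≤index {n} A b p s vertex p≗v Ap+s≡b (label , sound) = FinP.injective⇒≤ {f = label ∘ corner} corner-injective
  where
  corner : Fin (∏ (suc ∘ s)) → Vecℤ n
  corner t i = + toℕ (unpack (suc ∘ s) t i)

  corner≤s : ∀ t i → corner t i ℤ.≤ + s i
  corner≤s t i = ℤ.+≤+ (ℕ.s≤s⁻¹ (FinP.toℕ<n (unpack (suc ∘ s) t i)))

  below-b : ∀ d i → d ℤ.≤ + s i → (A · p) i + d ℤ.≤ b i
  below-b d i d≤s = subst ((A · p) i + d ℤ.≤_) (Ap+s≡b i) (ℤP.+-monoʳ-≤ ((A · p) i) d≤s)

  corner-injective : ∀ {t t′} → label (corner t) ≡ label (corner t′) → t ≡ t′
  corner-injective {t} {t′} labels≡ with sound (corner t) (corner t′) labels≡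
  ... | w , Aw≡ = unpack-injective (suc ∘ s) λ i →
    FinP.toℕ-injective (ℤP.+-injective (ℤP.i-j≡0⇒i≡j _ _ (trans (sym (Aw≡ i)) (A·w≡0 i))))
    where

    flip : ∀ a x y → a - (x - y) ≡ a + (y - x)
    flip = solve-∀

    w≡0 : ∀ i → w i ≡ 0ℤ
    w≡0 = vertex-rigid A b {p = p} {w} vertex p≗v
      (λ i → subst (ℤ._≤ b i) (sym (trans (·-distrib-+ A p w i) (cong (_+_ ((A · p) i)) (Aw≡ i))))
                   (below-b _ i (ℤP.i≤j⇒i-k≤j (corner t′ i) (corner≤s t i))))
      (λ i → subst (ℤ._≤ b i) (sym (trans (·-distrib-- A p w i) (trans (cong (_-_ ((A · p) i)) (Aw≡ i))
                                                                       (flip ((A · p) i) (corner t i) (corner t′ i)))))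
                   (below-b _ i (ℤP.i≤j⇒i-k≤j (corner t i) (corner≤s t′ i))))

    A·w≡0 : ∀ i → (A · w) i ≡ 0ℤ
    A·w≡0 i = sumℤ-zero λ j → trans (cong (A i j *_) (w≡0 j)) (ℤP.*-zeroʳ (A i j))

slack-integral : ∀ {n} (A : Matℤ n) (b p : Vecℤ n) (μ : Vecℚ n) →
                 (∀ i → mulℚ A (toℚ ∘ p) i ℚ.+ μ i ≡ toℚ (b i)) → (∀ i → 0ℚ ℚ.≤ μ i) →
                 ∃ λ (s : Fin n → ℕ) → (∀ i → μ i ≡ toℚ (+ s i)) × (∀ i → (A · p) i + + s i ≡ b i)
slack-integral {n} A b p μ Ap+μ≡b 0≤μ = (λ i → ∣ slack i ∣) , μ≡s , Ap+s≡b
  where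
  slack : Fin n → ℤ
  slack i = b i - (A · p) i

  cancelˡ : ∀ x m → m ≡ x ℚ.+ m ℚ.- x
  cancelˡ = RingSolver.solve-∀ ℚ-ring
  split : ∀ b a → b ≡ a + (b - a)
  split = solve-∀

  μ≡slack : ∀ i → μ i ≡ toℚ (slack i)
  μ≡slack i = begin
    μ i                                   ≡⟨ cancelˡ X (μ i) ⟩
    X ℚ.+ μ i ℚ.- X                       ≡⟨ cong (ℚ._- X) (trans (cong (ℚ._+ μ i) (sym (mulℚ-toℚ A p i)))
                                                                   (Ap+μ≡b i)) ⟩
    toℚ (b i) ℚ.- X                       ≡⟨ cong (λ z → toℚ z ℚ.- X) (split (b i) ((A · p) i)) ⟩
    toℚ ((A · p) i + slack i) ℚ.- X       ≡⟨ cong (ℚ._- X) (toℚ-+ ((A · p) i) (slack i)) ⟩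
    X ℚ.+ toℚ (slack i) ℚ.- X             ≡⟨ cancelˡ X (toℚ (slack i)) ⟨
    toℚ (slack i)                         ∎
    where
    open ≡-Reasoning
    X : ℚ
    X = toℚ ((A · p) i)

  +∣slack∣≡slack : ∀ i → + ∣ slack i ∣ ≡ slack i
  +∣slack∣≡slack i = ℤP.0≤i⇒+∣i∣≡i (toℚ-cancel-≤ (subst (0ℚ ℚ.≤_) (μ≡slack i) (0≤μ i)))

  μ≡s : ∀ i → μ i ≡ toℚ (+ ∣ slack i ∣)
  μ≡s i = trans (μ≡slack i) (cong toℚ (sym (+∣slack∣≡slack i)))

  Ap+s≡b : ∀ i → (A · p) i + + ∣ slack i ∣ ≡ b i
  Ap+s≡b i = trans (cong (_+_ ((A · p) i)) (+∣slack∣≡slack i)) (sym (split (b i) ((A · p) i)))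

lemma5 : (n : ℕ) (A : Matℤ n) (b : Vecℤ n) (Δ : ℕ) →
    ∣ det A ∣ ≡ Δ → Δ ≢ 0 →
    (v μ : Vecℚ n) →
    (∀ i → mulℚ A v i ℚ.+ μ i ≡ toℚ (b i)) →
    (∀ i → 0ℚ ℚ.≤ μ i) →
    IsVertex A b v →
    prodℚ (λ i → μ i ℚ.+ 1ℚ) ℚ.≤ toℚ (+ Δ)
lemma5 n A b Δ ∣detA∣≡Δ Δ≢0 v μ Av+μ≡b 0≤μ vertex =
  let p , _ , p≗v = vertex-integral A b v vertex
      Ap+μ≡b : ∀ i → mulℚ A (toℚ ∘ p) i ℚ.+ μ i ≡ toℚ (b i)
      Ap+μ≡b i = trans (cong (ℚ._+ μ i) (mulℚ-cong A p≗v i)) (Av+μ≡b i)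
      s , μ≡s , Ap+s≡b = slack-integral A b p μ Ap+μ≡b 0≤μ
      box≤Δ : ∏ (suc ∘ s) ℕ.≤ Δ
      box≤Δ = subst (∏ (suc ∘ s) ℕ.≤_) ∣detA∣≡Δ (box≤index A b p s vertex p≗v Ap+s≡b (index≤∣det∣ A detA≢0))
  in begin
    prodℚ (λ i → μ i ℚ.+ 1ℚ)         ≡⟨ prodℚ-cong (λ i → +1≡ (s i) (μ≡s i)) ⟩
    prodℚ (λ i → toℚ (+ suc (s i)))  ≡⟨ prodℚ-toℚ (suc ∘ s) ⟩
    toℚ (+ ∏ (suc ∘ s))              ≤⟨ toℚ-mono-≤ (ℤ.+≤+ box≤Δ) ⟩
    toℚ (+ Δ)                        ∎
  where
  open ℚP.≤-Reasoning

  +1≡ : ∀ {x} m → x ≡ toℚ (+ m) → x ℚ.+ 1ℚ ≡ toℚ (+ suc m)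
  +1≡ m refl = trans (ℚP.+-comm (toℚ (+ m)) 1ℚ) (sym (toℚ-+ 1ℤ (+ m)))

  detA≢0 : det A ≢ 0ℤ
  detA≢0 detA≡0 = Δ≢0 (trans (sym ∣detA∣≡Δ) (cong ∣_∣ detA≡0))
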